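{- Let $m$ and $n$ be non-negative integers. Then \[ \sum_{k = 1}^n k^m w_k = \mathcal P_1 (m,n;p,q)w_n + \mathcal P_2 (m,n;p,q)w_{n + 1} + \mathcal C(m;a,b,p,q), \] where $\mathcal P_1$, $\mathcal P_2$, $\mathcal C$ are defined recursively (for all non-negative integers $m$) by \[ (q - p + 1)\mathcal P_1 (m,n;p,q) = (n + 2)^m q - \sum_{j = 0}^{m - 1} \binom mj(2^{m - j} q - p)\mathcal P_1 (j,n;p,q), \] \[ (q - p + 1)\mathcal P_2 (m,n;p,q) = -(n + 1)^m - \sum_{j = 0}^{m - 1} \binom mj(2^{m - j} q - p)\mathcal P_2 (j,n;p,q), \] \[ (q - p + 1)\mathcal C (m;a,b,p,q) = -2^maq + b - \sum_{j = 0}^{m - 1} \binom mj(2^{m - j} q - p)\mathcal C (j;a,b,p,q). \]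
   Context: Let $a,b,p,q$ be complex numbers with $p\ne0$, $q\ne0$ and $p\ne q+1$. The Horadam sequence $(w_j)=(w_j(a,b;p,q))$ is defined by $w_0=a$, $w_1=b$, $w_j=pw_{j-1}-qw_{j-2}$ for $j\ge2$. Empty sums are $0$ and $0^0=1$. -}

module Defs where

open import Level using (Level)
open import Data.Nat as ℕ using (ℕ; zero; suc; _∸_; _≡ᵇ_)
open import Data.Bool using (if_then_else_)
open import Data.Nat.Combinatorics using (_C_)
open import Algebra.Bundles using (CommutativeRing; Semiring)
import Algebra.Definitions.RawSemiring as RawSemiringDefs

-- Everything is stated over an arbitrary commutative ring R (the paper uses ℂ).
module Horadam {c ℓ : Level} (R : CommutativeRing c ℓ) where
  open CommutativeRing R
  open RawSemiringDefs (Semiring.rawSemiring semiring) public using (_×_; _^_)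

  ι : ℕ → Carrier
  ι k = k × 1#

  w : (a b p q : Carrier) → ℕ → Carrier
  w a b p q zero = a
  w a b p q (suc zero) = b
  w a b p q (suc (suc j)) = p * w a b p q (suc j) - q * w a b p q j

  sumTo : ℕ → (ℕ → Carrier) → Carrier
  sumTo zero f = 0#
  sumTo (suc m) f = sumTo m f + f m

  -- course-of-values recursion: cov step k j = value at j, correct for j < k,
  -- where the value at m is  step m (values at 0..m-1).
  cov : (ℕ → (ℕ → Carrier) → Carrier) → ℕ → ℕ → Carrier
  cov step zero j = 0#
  cov step (suc m) j = if j ≡ᵇ m then step m (cov step m) else cov step m j

  valueAt : (ℕ → (ℕ → Carrier) → Carrier) → ℕ → Carrier
  valueAt step m = cov step (suc m) m

  corr : (p q : Carrier) → ℕ → (ℕ → Carrier) → Carrier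
  corr p q m X = sumTo m (λ j → ι (m C j) * ((ι 2 ^ (m ∸ j)) * q - p) * X j)

  -- u is the inverse of (q - p + 1); each recursion reads
  -- (q-p+1) X(m) = RHS(m), i.e. X(m) = u * RHS(m).
  𝒫₁ : (p q u : Carrier) → ℕ → ℕ → Carrier
  𝒫₁ p q u n = valueAt (λ m X → u * (ι (n ℕ.+ 2) ^ m * q - corr p q m X))

  𝒫₂ : (p q u : Carrier) → ℕ → ℕ → Carrier
  𝒫₂ p q u n = valueAt (λ m X → u * (- (ι (n ℕ.+ 1) ^ m) - corr p q m X))

  𝒞 : (a b p q u : Carrier) → ℕ → Carrier
  𝒞 a b p q u = valueAt (λ m X → u * (- (ι 2 ^ m * a * q) + b - corr p q m X))

{-# OPTIONS --safe #-}
-- Let S_m = Σ_{k=1}^n k^m w_k. By the binomial theorem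
--   q (x+2)^m - p (x+1)^m + x^m = (q-p+1) x^m + Σ_{j<m} C(m,j) (2^{m-j} q - p) x^j,
-- and the left-hand side, weighted by w_x and summed over x = 1..n, telescopes through
-- w_{x+1} = p w_x - q w_{x-1} to (n+2)^m q w_n - (n+1)^m w_{n+1} - 2^m a q + b.
-- Hence S satisfies the same recursion in m as 𝒫₁ w_n + 𝒫₂ w_{n+1} + 𝒞, and since
-- q-p+1 is invertible that recursion has only one solution.
module Submission where

open import Defs
open import Level using (Level; _⊔_)
open import Data.Nat as ℕ using (ℕ; zero; suc; _<_; _∸_)
import Data.Nat.Properties as ℕ
open import Data.Nat.Induction using (<-rec)
open import Data.Nat.Combinatorics using (_C_; nCn≡1)
open import Data.Integer as ℤ using (ℤ; +_; -[1+_]; _⊖_)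
import Data.Integer.Properties as ℤ
open import Data.Sign as Sign using (Sign)
open import Data.Bool using (true; false; T)
open import Data.Unit using (tt)
open import Data.Fin using (toℕ)
open import Data.Maybe using (Maybe; just; nothing)
open import Relation.Nullary using (¬_; yes; no)
open import Relation.Binary.PropositionalEquality as ≡ using (_≡_)
open import Algebra.Bundles using (CommutativeRing)
open import Algebra.Solver.Ring.AlmostCommutativeRing
  using (_-Raw-AlmostCommutative⟶_; fromCommutativeRing)

-- The ring solver needs coefficients with decidable equality to normalise x - x to 0,
-- so it is run with integer coefficients, interpreted in R as signed multiples of 1#.
module IntegerCoefficients {c ℓ : Level} (R : CommutativeRing c ℓ) where
  open CommutativeRing R
  open Horadam R using (ι)
  open import Relation.Binary.Reasoning.Setoid setoid
  open import Algebra.Properties.Monoid.Mult +-monoid using (×-homo-+)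
  open import Algebra.Properties.Semiring.Mult semiring using (×1-homo-*)
  open import Algebra.Properties.Ring ring
    using (-‿distribˡ-*; -‿distribʳ-*; -0#≈0#; -‿involutive; -‿+-comm)

  ⟦_⟧ : ℤ → Carrier
  ⟦ + n ⟧ = ι n
  ⟦ -[1+ n ] ⟧ = - ι (suc n)

  signed : Sign → Carrier → Carrier
  signed Sign.+ x = x
  signed Sign.- x = - x

  signed-cong : ∀ s {x y} → x ≈ y → signed s x ≈ signed s y
  signed-cong Sign.+ x≈y = x≈y
  signed-cong Sign.- x≈y = -‿cong x≈y

  signed-* : ∀ s t x y → signed (s Sign.* t) (x * y) ≈ signed s x * signed t y
  signed-* Sign.+ Sign.+ x y = refl
  signed-* Sign.+ Sign.- x y = -‿distribʳ-* x y
  signed-* Sign.- Sign.+ x y = -‿distribˡ-* x y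
  signed-* Sign.- Sign.- x y = begin
    x * y         ≈⟨ sym (-‿involutive _) ⟩
    - - (x * y)   ≈⟨ -‿cong (-‿distribʳ-* x y) ⟩
    - (x * - y)   ≈⟨ -‿distribˡ-* x (- y) ⟩
    - x * - y     ∎

  ⟦◃⟧ : ∀ s n → ⟦ s ℤ.◃ n ⟧ ≈ signed s (ι n)
  ⟦◃⟧ Sign.+ zero = refl
  ⟦◃⟧ Sign.- zero = sym -0#≈0#
  ⟦◃⟧ Sign.+ (suc n) = refl
  ⟦◃⟧ Sign.- (suc n) = refl

  ⟦⟧≈signed∣∣ : ∀ i → ⟦ i ⟧ ≈ signed (ℤ.sign i) (ι ℤ.∣ i ∣)
  ⟦⟧≈signed∣∣ (+ n) = refl
  ⟦⟧≈signed∣∣ -[1+ n ] = refl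

  +-cancelˡ-- : ∀ x y z → (x + y) - (x + z) ≈ y - z
  +-cancelˡ-- x y z = begin
    (x + y) + - (x + z)    ≈⟨ +-cong (+-comm x y) (sym (-‿+-comm x z)) ⟩
    (y + x) + (- x + - z)  ≈⟨ +-assoc y x _ ⟩
    y + (x + (- x + - z))  ≈⟨ +-congˡ (sym (+-assoc x (- x) (- z))) ⟩
    y + ((x + - x) + - z)  ≈⟨ +-congˡ (+-congʳ (-‿inverseʳ x)) ⟩
    y + (0# + - z)         ≈⟨ +-congˡ (+-identityˡ (- z)) ⟩
    y - z                  ∎

  ⟦⊖⟧ : ∀ m n → ⟦ m ⊖ n ⟧ ≈ ι m - ι n
  ⟦⊖⟧ m zero = sym (trans (+-congˡ -0#≈0#) (+-identityʳ _))
  ⟦⊖⟧ zero (suc n) = sym (+-identityˡ _)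
  ⟦⊖⟧ (suc m) (suc n) rewrite ℤ.[1+m]⊖[1+n]≡m⊖n m n =
    trans (⟦⊖⟧ m n) (sym (+-cancelˡ-- 1# (ι m) (ι n)))

  ⟦+⟧ : ∀ i j → ⟦ i ℤ.+ j ⟧ ≈ ⟦ i ⟧ + ⟦ j ⟧
  ⟦+⟧ (+ m) (+ n) = ×-homo-+ 1# m n
  ⟦+⟧ (+ m) -[1+ n ] = ⟦⊖⟧ m (suc n)
  ⟦+⟧ -[1+ m ] (+ n) = trans (⟦⊖⟧ n (suc m)) (+-comm _ _)
  ⟦+⟧ -[1+ m ] -[1+ n ] = begin
    - ι (suc (suc (m ℕ.+ n)))   ≡⟨ ≡.cong (λ k → - ι (suc k)) (ℕ.+-suc m n) ⟨
    - ι (suc m ℕ.+ suc n)       ≈⟨ -‿cong (×-homo-+ 1# (suc m) (suc n)) ⟩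
    - (ι (suc m) + ι (suc n))   ≈⟨ -‿+-comm _ _ ⟨
    - ι (suc m) + - ι (suc n)   ∎

  ⟦*⟧ : ∀ i j → ⟦ i ℤ.* j ⟧ ≈ ⟦ i ⟧ * ⟦ j ⟧
  ⟦*⟧ i j = begin
    ⟦ i ℤ.* j ⟧                                 ≈⟨ ⟦◃⟧ s (ℤ.∣ i ∣ ℕ.* ℤ.∣ j ∣) ⟩
    signed s (ι (ℤ.∣ i ∣ ℕ.* ℤ.∣ j ∣))          ≈⟨ signed-cong s (×1-homo-* ℤ.∣ i ∣ ℤ.∣ j ∣) ⟩
    signed s (ι ℤ.∣ i ∣ * ι ℤ.∣ j ∣)             ≈⟨ signed-* (ℤ.sign i) (ℤ.sign j) _ _ ⟩
    signed (ℤ.sign i) (ι ℤ.∣ i ∣) * signed (ℤ.sign j) (ι ℤ.∣ j ∣)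
                                                ≈⟨ *-cong (⟦⟧≈signed∣∣ i) (⟦⟧≈signed∣∣ j) ⟨
    ⟦ i ⟧ * ⟦ j ⟧                               ∎
    where
    s : Sign
    s = ℤ.sign i Sign.* ℤ.sign j

  ⟦-⟧ : ∀ i → ⟦ ℤ.- i ⟧ ≈ - ⟦ i ⟧
  ⟦-⟧ -[1+ n ] = sym (-‿involutive _)
  ⟦-⟧ (+ zero) = sym -0#≈0#
  ⟦-⟧ (+ suc n) = refl

  morphism : ℤ.+-*-rawRing -Raw-AlmostCommutative⟶ fromCommutativeRing R
  morphism = record
    { ⟦_⟧ = ⟦_⟧
    ; +-homo = ⟦+⟧
    ; *-homo = ⟦*⟧
    ; -‿homo = ⟦-⟧
    ; 0-homo = refl
    ; 1-homo = +-identityʳ 1#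
    }

  equal? : ∀ i j → Maybe (⟦ i ⟧ ≈ ⟦ j ⟧)
  equal? i j with i ℤ.≟ j
  ... | yes ≡.refl = just refl
  ... | no _ = nothing

  open import Algebra.Solver.Ring ℤ.+-*-rawRing (fromCommutativeRing R) morphism equal? public
    using (solve; _:=_; _:+_; _:*_; _:-_; :-_; con)

module PowerSums {c ℓ : Level} (R : CommutativeRing c ℓ) where
  open CommutativeRing R
  open Horadam R
  open IntegerCoefficients R using (solve; _:=_; _:+_; _:*_; _:-_; :-_; con)
  open import Relation.Binary.Reasoning.Setoid setoid
  open import Algebra.Properties.Monoid.Mult +-monoid using (×-homo-+; ×-congʳ)
  open import Algebra.Properties.Semiring.Mult semiring using (×-assoc-*)
  open import Algebra.Properties.Semiring.Exp semiring using (^-congˡ)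
  open import Algebra.Properties.Semiring.Sum semiring using (sum)
  import Algebra.Properties.CommutativeSemiring.Binomial commutativeSemiring as Binomial

  sumTo-cong-< : ∀ m {f g : ℕ → Carrier} → (∀ j → j < m → f j ≈ g j) → sumTo m f ≈ sumTo m g
  sumTo-cong-< zero f≈g = refl
  sumTo-cong-< (suc m) f≈g =
    +-cong (sumTo-cong-< m (λ j j<m → f≈g j (ℕ.m<n⇒m<1+n j<m))) (f≈g m (ℕ.n<1+n m))

  sumTo-cong : ∀ m {f g : ℕ → Carrier} → (∀ j → f j ≈ g j) → sumTo m f ≈ sumTo m g
  sumTo-cong m f≈g = sumTo-cong-< m (λ j _ → f≈g j)

  sumTo-+ : ∀ m (f g : ℕ → Carrier) → sumTo m (λ j → f j + g j) ≈ sumTo m f + sumTo m g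
  sumTo-+ zero f g = sym (+-identityʳ 0#)
  sumTo-+ (suc m) f g = begin
    sumTo m (λ j → f j + g j) + (f m + g m)  ≈⟨ +-congʳ (sumTo-+ m f g) ⟩
    (sumTo m f + sumTo m g) + (f m + g m)    ≈⟨ solve 4 (λ F G x y → (F :+ G) :+ (x :+ y) := (F :+ x) :+ (G :+ y))
                                                   refl (sumTo m f) (sumTo m g) (f m) (g m) ⟩
    (sumTo m f + f m) + (sumTo m g + g m)    ∎

  *-distribˡ-sumTo : ∀ m x (f : ℕ → Carrier) → x * sumTo m f ≈ sumTo m (λ j → x * f j)
  *-distribˡ-sumTo zero x f = zeroʳ x
  *-distribˡ-sumTo (suc m) x f = trans (distribˡ x (sumTo m f) (f m)) (+-congʳ (*-distribˡ-sumTo m x f))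

  *-distribʳ-sumTo : ∀ m x (f : ℕ → Carrier) → sumTo m f * x ≈ sumTo m (λ j → f j * x)
  *-distribʳ-sumTo zero x f = zeroˡ x
  *-distribʳ-sumTo (suc m) x f = trans (distribʳ x (sumTo m f) (f m)) (+-congʳ (*-distribʳ-sumTo m x f))

  sumTo-zero : ∀ n → sumTo n (λ _ → 0#) ≈ 0#
  sumTo-zero zero = refl
  sumTo-zero (suc n) = trans (+-identityʳ _) (sumTo-zero n)

  sumTo-comm : ∀ m n (h : ℕ → ℕ → Carrier) →
    sumTo m (λ j → sumTo n (h j)) ≈ sumTo n (λ i → sumTo m (λ j → h j i))
  sumTo-comm zero n h = sym (sumTo-zero n)
  sumTo-comm (suc m) n h = begin
    sumTo m (λ j → sumTo n (h j)) + sumTo n (h m)            ≈⟨ +-congʳ (sumTo-comm m n h) ⟩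
    sumTo n (λ i → sumTo m (λ j → h j i)) + sumTo n (h m)    ≈⟨ sumTo-+ n _ _ ⟨
    sumTo n (λ i → sumTo m (λ j → h j i) + h m i)            ∎

  sumTo-suc : ∀ m (f : ℕ → Carrier) → sumTo (suc m) f ≈ f 0 + sumTo m (λ j → f (suc j))
  sumTo-suc zero f = trans (+-identityˡ _) (sym (+-identityʳ _))
  sumTo-suc (suc m) f = trans (+-congʳ (sumTo-suc m f)) (+-assoc _ _ _)

  sum≈sumTo : ∀ m (f : ℕ → Carrier) → sum {m} (λ k → f (toℕ k)) ≈ sumTo m f
  sum≈sumTo zero f = refl
  sum≈sumTo (suc m) f = trans (+-congˡ (sum≈sumTo m (λ j → f (suc j)))) (sym (sumTo-suc m f))

  ι-+ : ∀ m n → ι (m ℕ.+ n) ≈ ι m + ι n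
  ι-+ m n = ×-homo-+ 1# m n

  ×≈ι* : ∀ n x → n × x ≈ ι n * x
  ×≈ι* n x = sym (trans (×-assoc-* n 1# x) (×-congʳ n (*-identityˡ x)))

  ι1^≈1 : ∀ k → ι 1 ^ k ≈ 1#
  ι1^≈1 zero = refl
  ι1^≈1 (suc k) = trans (*-cong (+-identityʳ 1#) (ι1^≈1 k)) (*-identityˡ 1#)

  binomial : ∀ m x y → (x + y) ^ m ≈ sumTo m (λ j → ι (m C j) * (x ^ j * y ^ (m ∸ j))) + x ^ m
  binomial m x y = begin
    (x + y) ^ m                      ≈⟨ Binomial.theorem m x y ⟩
    sum {suc m} (λ k → term (toℕ k)) ≈⟨ sum≈sumTo (suc m) term ⟩
    sumTo m term + term m            ≈⟨ +-cong (sumTo-cong m (λ j → ×≈ι* (m C j) _)) top ⟩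
    sumTo m (λ j → ι (m C j) * (x ^ j * y ^ (m ∸ j))) + x ^ m ∎
    where
    term : ℕ → Carrier
    term j = (m C j) × (x ^ j * y ^ (m ∸ j))
    top : term m ≈ x ^ m
    top rewrite nCn≡1 m | ℕ.n∸n≡0 m = trans (+-identityʳ _) (*-identityʳ _)

  Causal : (ℕ → (ℕ → Carrier) → Carrier) → Set (c ⊔ ℓ)
  Causal step = ∀ m {X Y} → (∀ j → j < m → X j ≈ Y j) → step m X ≈ step m Y

  valueAt-step : ∀ step m → valueAt step m ≡ step m (cov step m)
  valueAt-step step m with m ℕ.≡ᵇ m | ℕ.≡⇒≡ᵇ m m ≡.refl
  ... | true  | _ = ≡.refl
  ... | false | ()

  cov≡valueAt : ∀ step {m} j → j < m → cov step m j ≡ valueAt step j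
  cov≡valueAt step {suc m} j j<1+m with j ℕ.≡ᵇ m in j≡ᵇm
  ... | true rewrite ℕ.≡ᵇ⇒≡ j m (≡.subst T (≡.sym j≡ᵇm) tt) = ≡.sym (valueAt-step step m)
  ... | false = cov≡valueAt step j (ℕ.≤∧≢⇒< (ℕ.s≤s⁻¹ j<1+m) j≢m)
    where
    j≢m : ¬ j ≡ m
    j≢m j≡m = ≡.subst T j≡ᵇm (ℕ.≡⇒≡ᵇ j m j≡m)

  valueAt-recursion : ∀ {step} → Causal step → ∀ m → valueAt step m ≈ step m (valueAt step)
  valueAt-recursion {step} causal m = trans (reflexive (valueAt-step step m))
    (causal m (λ j j<m → reflexive (cov≡valueAt step j j<m)))

  recursion-unique : ∀ {step X Y} → Causal step →
    (∀ m → X m ≈ step m X) → (∀ m → Y m ≈ step m Y) → ∀ m → X m ≈ Y m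
  recursion-unique {X = X} {Y} causal X-rec Y-rec = <-rec (λ m → X m ≈ Y m) λ m X≈Y-below →
    trans (X-rec m) (trans (causal m (λ j j<m → X≈Y-below j<m)) (sym (Y-rec m)))

  module _ (p q : Carrier) where

    coefficient : ℕ → ℕ → Carrier
    coefficient m j = ι (m C j) * (ι 2 ^ (m ∸ j) * q - p)

    corr-causal : ∀ u (r : ℕ → Carrier) → Causal (λ m X → u * (r m - corr p q m X))
    corr-causal u r m X≈Y = *-congˡ (+-congˡ (-‿cong (sumTo-cong-< m (λ j j<m → *-congˡ (X≈Y j j<m)))))

    corr-+ : ∀ m (X Y : ℕ → Carrier) → corr p q m (λ j → X j + Y j) ≈ corr p q m X + corr p q m Y
    corr-+ m X Y = trans (sumTo-cong m (λ j → distribˡ _ (X j) (Y j))) (sumTo-+ m _ _)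

    corr-*ʳ : ∀ m (X : ℕ → Carrier) x → corr p q m (λ j → X j * x) ≈ corr p q m X * x
    corr-*ʳ m X x = trans (sumTo-cong m (λ j → sym (*-assoc _ (X j) x))) (sym (*-distribʳ-sumTo m x _))

    shifted-powers : ∀ m x → q * (x + ι 2) ^ m - p * (x + ι 1) ^ m + x ^ m
                             ≈ (q - p + 1#) * x ^ m + sumTo m (λ j → coefficient m j * x ^ j)
    shifted-powers m x = begin
      q * (x + ι 2) ^ m - p * (x + ι 1) ^ m + x ^ m
        ≈⟨ +-congʳ (+-cong (*-congˡ (binomial m x (ι 2))) (-‿cong (*-congˡ (binomial m x (ι 1))))) ⟩
      q * (sumTo m (term 2) + x ^ m) - p * (sumTo m (term 1) + x ^ m) + x ^ m
        ≈⟨ regroup (sumTo m (term 2)) (sumTo m (term 1)) (x ^ m) ⟩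
      ((q - p) * x ^ m + x ^ m) + (q * sumTo m (term 2) + - p * sumTo m (term 1))
        ≈⟨ +-cong (sym (trans (distribʳ (x ^ m) (q - p) 1#) (+-congˡ (*-identityˡ (x ^ m)))))
                  (+-cong (*-distribˡ-sumTo m q _) (*-distribˡ-sumTo m (- p) _)) ⟩
      (q - p + 1#) * x ^ m + (sumTo m (λ j → q * term 2 j) + sumTo m (λ j → - p * term 1 j))
        ≈⟨ +-congˡ (sumTo-+ m _ _) ⟨
      (q - p + 1#) * x ^ m + sumTo m (λ j → q * term 2 j + - p * term 1 j)
        ≈⟨ +-congˡ (sumTo-cong m combine) ⟩
      (q - p + 1#) * x ^ m + sumTo m (λ j → coefficient m j * x ^ j) ∎
      where
      term : ℕ → ℕ → Carrier
      term d j = ι (m C j) * (x ^ j * ι d ^ (m ∸ j))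
      regroup : ∀ B₂ B₁ y → q * (B₂ + y) - p * (B₁ + y) + y ≈ ((q - p) * y + y) + (q * B₂ + - p * B₁)
      regroup = solve 5 (λ q p B₂ B₁ y →
        q :* (B₂ :+ y) :- p :* (B₁ :+ y) :+ y := ((q :- p) :* y :+ y) :+ (q :* B₂ :+ (:- p) :* B₁))
        refl q p
      combine : ∀ j → q * term 2 j + - p * term 1 j ≈ coefficient m j * x ^ j
      combine j = trans (+-congˡ (*-congˡ (*-congˡ (trans (*-congˡ (ι1^≈1 (m ∸ j))) (*-identityʳ (x ^ j))))))
        (solve 5 (λ q p C y T → q :* (C :* (y :* T)) :+ (:- p) :* (C :* y) := C :* (T :* q :- p) :* y)
           refl q p (ι (m C j)) (x ^ j) (ι 2 ^ (m ∸ j)))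

    module _ (a b : Carrier) where

      telescope : ∀ (f : ℕ → Carrier) n →
        sumTo n (λ i → (q * f (3 ℕ.+ i) - p * f (2 ℕ.+ i) + f (1 ℕ.+ i)) * w a b p q (1 ℕ.+ i))
          ≈ f (2 ℕ.+ n) * q * w a b p q n + - f (1 ℕ.+ n) * w a b p q (1 ℕ.+ n)
            + (- (f 2 * a * q) + f 1 * b)
      telescope f zero = solve 5 (λ q a b F₂ F₁ →
        con (+ 0) := F₂ :* q :* a :+ (:- F₁) :* b :+ ((:- (F₂ :* a :* q)) :+ F₁ :* b)) refl q a b (f 2) (f 1)
      telescope f (suc n) = trans (+-congʳ (telescope f n))
        (solve 8 (λ q p F₃ F₂ F₁ W₀ W₁ B →
            (F₂ :* q :* W₀ :+ (:- F₁) :* W₁ :+ B) :+ (q :* F₃ :- p :* F₂ :+ F₁) :* W₁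
              := F₃ :* q :* W₁ :+ (:- F₂) :* (p :* W₁ :- q :* W₀) :+ B)
          refl q p (f (3 ℕ.+ n)) (f (2 ℕ.+ n)) (f (1 ℕ.+ n)) (w a b p q n) (w a b p q (1 ℕ.+ n)) _)

      powerSum : ℕ → ℕ → Carrier
      powerSum n m = sumTo n (λ i → ι (suc i) ^ m * w a b p q (suc i))

      boundary : ℕ → ℕ → Carrier
      boundary n m = ι (n ℕ.+ 2) ^ m * q * w a b p q n + - (ι (n ℕ.+ 1) ^ m) * w a b p q (suc n)
                     + (- (ι 2 ^ m * a * q) + b)

      powerSum-recursion : ∀ n m → (q - p + 1#) * powerSum n m + corr p q m (powerSum n) ≈ boundary n m
      powerSum-recursion n m = begin
        (q - p + 1#) * powerSum n m + corr p q m (powerSum n)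
          ≈⟨ +-cong (*-distribˡ-sumTo n _ _) (sumTo-cong m (λ j → *-distribˡ-sumTo n (coefficient m j) _)) ⟩
        sumTo n (λ i → (q - p + 1#) * (x i ^ m * W i))
          + sumTo m (λ j → sumTo n (λ i → coefficient m j * (x i ^ j * W i)))
          ≈⟨ +-congˡ (sumTo-comm m n _) ⟩
        sumTo n (λ i → (q - p + 1#) * (x i ^ m * W i))
          + sumTo n (λ i → sumTo m (λ j → coefficient m j * (x i ^ j * W i)))
          ≈⟨ sumTo-+ n _ _ ⟨
        sumTo n (λ i → (q - p + 1#) * (x i ^ m * W i) + sumTo m (λ j → coefficient m j * (x i ^ j * W i)))
          ≈⟨ sumTo-cong n (λ i → trans (factor i) (*-congʳ (sym (shifted-powers m (x i))))) ⟩
        sumTo n (λ i → (q * (x i + ι 2) ^ m - p * (x i + ι 1) ^ m + x i ^ m) * W i)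
          ≈⟨ sumTo-cong n (λ i → *-congʳ (reindex i)) ⟩
        sumTo n (λ i → (q * ι (3 ℕ.+ i) ^ m - p * ι (2 ℕ.+ i) ^ m + ι (1 ℕ.+ i) ^ m) * W i)
          ≈⟨ telescope (λ k → ι k ^ m) n ⟩
        ι (2 ℕ.+ n) ^ m * q * w a b p q n + - (ι (1 ℕ.+ n) ^ m) * w a b p q (suc n)
          + (- (ι 2 ^ m * a * q) + ι 1 ^ m * b)
          ≡⟨ ≡.cong₂ (λ k l → ι k ^ m * q * w a b p q n + - (ι l ^ m) * w a b p q (suc n)
                             + (- (ι 2 ^ m * a * q) + ι 1 ^ m * b))
                     (ℕ.+-comm 2 n) (ℕ.+-comm 1 n) ⟩
        ι (n ℕ.+ 2) ^ m * q * w a b p q n + - (ι (n ℕ.+ 1) ^ m) * w a b p q (suc n)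
          + (- (ι 2 ^ m * a * q) + ι 1 ^ m * b)
          ≈⟨ +-congˡ (+-congˡ (trans (*-congʳ (ι1^≈1 m)) (*-identityˡ b))) ⟩
        boundary n m ∎
        where
        x W : ℕ → Carrier
        x i = ι (suc i)
        W i = w a b p q (suc i)
        factor : ∀ i → (q - p + 1#) * (x i ^ m * W i) + sumTo m (λ j → coefficient m j * (x i ^ j * W i))
                       ≈ ((q - p + 1#) * x i ^ m + sumTo m (λ j → coefficient m j * x i ^ j)) * W i
        factor i = sym (trans (distribʳ (W i) _ _) (+-cong (*-assoc _ _ _)
          (trans (*-distribʳ-sumTo m (W i) _) (sumTo-cong m (λ j → *-assoc _ _ _)))))
        shift : ∀ d i → (x i + ι d) ^ m ≈ ι (d ℕ.+ suc i) ^ m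
        shift d i = ^-congˡ m (sym (trans (ι-+ d (suc i)) (+-comm _ _)))
        reindex : ∀ i → q * (x i + ι 2) ^ m - p * (x i + ι 1) ^ m + x i ^ m
                        ≈ q * ι (3 ℕ.+ i) ^ m - p * ι (2 ℕ.+ i) ^ m + ι (1 ℕ.+ i) ^ m
        reindex i = +-congʳ (+-cong (*-congˡ (shift 2 i)) (-‿cong (*-congˡ (shift 1 i))))

      powerSum-solves : ∀ {u} → (q - p + 1#) * u ≈ 1# → ∀ n m →
        powerSum n m ≈ u * (boundary n m - corr p q m (powerSum n))
      powerSum-solves {u} inverse n m = begin
        powerSum n m                    ≈⟨ *-identityˡ _ ⟨
        1# * powerSum n m               ≈⟨ *-congʳ inverse ⟨
        (q - p + 1#) * u * powerSum n m ≈⟨ cancel (q - p + 1#) (powerSum n m) (corr p q m (powerSum n)) ⟩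
        u * ((q - p + 1#) * powerSum n m + corr p q m (powerSum n) - corr p q m (powerSum n))
                                        ≈⟨ *-congˡ (+-congʳ (powerSum-recursion n m)) ⟩
        u * (boundary n m - corr p q m (powerSum n)) ∎
        where
        cancel : ∀ v S c → v * u * S ≈ u * (v * S + c - c)
        cancel = solve 4 (λ u v S c → v :* u :* S := u :* (v :* S :+ c :- c)) refl u

      closedForm : Carrier → ℕ → ℕ → Carrier
      closedForm u n m = 𝒫₁ p q u n m * w a b p q n + 𝒫₂ p q u n m * w a b p q (suc n) + 𝒞 a b p q u m

      closedForm-solves : ∀ u n m → closedForm u n m ≈ u * (boundary n m - corr p q m (closedForm u n))
      closedForm-solves u n m = begin
        closedForm u n m
          ≈⟨ +-cong (+-cong (*-congʳ (valueAt-recursion (corr-causal u (λ k → ι (n ℕ.+ 2) ^ k * q)) m))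
                            (*-congʳ (valueAt-recursion (corr-causal u (λ k → - (ι (n ℕ.+ 1) ^ k))) m)))
                    (valueAt-recursion (corr-causal u (λ k → - (ι 2 ^ k * a * q) + b)) m) ⟩
        u * (ι (n ℕ.+ 2) ^ m * q - corr p q m P₁) * W₀ + u * (- (ι (n ℕ.+ 1) ^ m) - corr p q m P₂) * W₁
          + u * (- (ι 2 ^ m * a * q) + b - corr p q m Cₘ)
          ≈⟨ distribute u (ι (n ℕ.+ 2) ^ m * q) (- (ι (n ℕ.+ 1) ^ m)) (- (ι 2 ^ m * a * q) + b)
                          (corr p q m P₁) (corr p q m P₂) (corr p q m Cₘ) ⟩
        u * (boundary n m - (corr p q m P₁ * W₀ + corr p q m P₂ * W₁ + corr p q m Cₘ))
          ≈⟨ *-congˡ (+-congˡ (-‿cong (sym (trans (corr-+ m _ _)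
                (+-congʳ (trans (corr-+ m _ _) (+-cong (corr-*ʳ m P₁ W₀) (corr-*ʳ m P₂ W₁)))))))) ⟩
        u * (boundary n m - corr p q m (closedForm u n)) ∎
        where
        P₁ P₂ Cₘ : ℕ → Carrier
        P₁ = 𝒫₁ p q u n
        P₂ = 𝒫₂ p q u n
        Cₘ = 𝒞 a b p q u
        W₀ W₁ : Carrier
        W₀ = w a b p q n
        W₁ = w a b p q (suc n)
        distribute : ∀ v A₁ A₂ A₃ c₁ c₂ c₃ →
          v * (A₁ - c₁) * W₀ + v * (A₂ - c₂) * W₁ + v * (A₃ - c₃)
            ≈ v * ((A₁ * W₀ + A₂ * W₁ + A₃) - (c₁ * W₀ + c₂ * W₁ + c₃))
        distribute = solve 9 (λ W₀ W₁ v A₁ A₂ A₃ c₁ c₂ c₃ →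
          v :* (A₁ :- c₁) :* W₀ :+ v :* (A₂ :- c₂) :* W₁ :+ v :* (A₃ :- c₃)
            := v :* ((A₁ :* W₀ :+ A₂ :* W₁ :+ A₃) :- (c₁ :* W₀ :+ c₂ :* W₁ :+ c₃))) refl W₀ W₁

theorem3 : {c ℓ : Level} (R : CommutativeRing c ℓ) →
    let open CommutativeRing R
        open Horadam R
    in (a b p q u : Carrier) →
       ¬ (p ≈ 0#) → ¬ (q ≈ 0#) →
       (q - p + 1#) * u ≈ 1# →
       (m n : ℕ) →
       sumTo n (λ i → ι (suc i) ^ m * w a b p q (suc i))
         ≈ 𝒫₁ p q u n m * w a b p q n
           + 𝒫₂ p q u n m * w a b p q (suc n)
           + 𝒞 a b p q u m
theorem3 R a b p q u _ _ inverse m n =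
  recursion-unique (corr-causal p q u (boundary p q a b n))
    (powerSum-solves p q a b inverse n) (closedForm-solves p q a b u n) m
  where open PowerSums R
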